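{- Let $n\ge1$ be an integer, $q$ a prime power, and $\{e_1,\dots,e_n\}$ a linear basis of $\mathbb{F}_q^n$. Let $$A:=\{\varepsilon_1e_1+\dots+\varepsilon_ne_n:\varepsilon_1,\dots,\varepsilon_n\in\mathbb{F}_q^\times\},\qquad B:=\{\varepsilon_1e_1+\dots+\varepsilon_ne_n:\varepsilon_1,\dots,\varepsilon_n\in\{0,1\}\}.$$ Then $K:=A\cup B$ is a rank-$1$ Kakeya set in $\mathbb{F}_q^n$ and $|K|=(q-1)^n+2^n-1$.
   Context: $\mathbb{F}_q$ denotes the finite field with $q$ elements and $\mathbb{F}_q^\times$ its set of non-zero elements. A subset $K\subseteq\mathbb{F}_q^n$ is a rank-$1$ Kakeya set if for every one-dimensional subspace $L\le\mathbb{F}_q^n$ there exists $v\in\mathbb{F}_q^n$ with $v+L\subseteq K$. -}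

module Defs where

open import Data.Nat using (ℕ; zero; suc; _^_)
open import Data.Nat.Primality using (Prime)
open import Data.Fin using (Fin)
import Data.Fin as Fin
open import Data.Vec using (Vec; replicate; zipWith; map)
open import Data.Bool using (Bool; true; false; if_then_else_)
open import Data.Product using (Σ; ∃; _×_; _,_)
open import Data.Sum using (_⊎_)
open import Function using (_∘_)
open import Function.Bundles using (_↔_)
open import Function.Definitions using (Injective)
open import Relation.Binary.PropositionalEquality using (_≡_; _≢_)
open import Algebra.Structures using (IsCommutativeRing)

IsPrimePower : ℕ → Set
IsPrimePower q = ∃ λ p → ∃ λ k → Prime p × q ≡ p ^ suc k

record FiniteField (q : ℕ) : Set₁ where
  infixl 6 _+_
  infixl 7 _*_
  field
    Carrier    : Set
    _+_ _*_    : Carrier → Carrier → Carrier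
    -_         : Carrier → Carrier
    0# 1#      : Carrier
    isCommutativeRing : IsCommutativeRing _≡_ _+_ _*_ -_ 0# 1#
    0≢1        : 0# ≢ 1#
    inverse    : ∀ x → x ≢ 0# → ∃ λ y → x * y ≡ 1#
    card       : Carrier ↔ Fin q

HasSize : {X : Set} → (X → Set) → ℕ → Set
HasSize {X} S m =
  Σ (Fin m → X) λ f → Injective _≡_ _≡_ f × (∀ i → S (f i)) × (∀ x → S x → ∃ λ i → f i ≡ x)

module _ {q : ℕ} (F : FiniteField q) where
  open FiniteField F

  Vect : ℕ → Set
  Vect n = Vec Carrier n

  zeroᵥ : ∀ {n} → Vect n
  zeroᵥ = replicate _ 0#

  _+ᵥ_ : ∀ {n} → Vect n → Vect n → Vect n
  _+ᵥ_ = zipWith _+_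

  _·ᵥ_ : ∀ {n} → Carrier → Vect n → Vect n
  t ·ᵥ v = map (t *_) v

  lincomb : ∀ {n k} → (Fin k → Carrier) → (Fin k → Vect n) → Vect n
  lincomb {k = zero}  c e = zeroᵥ
  lincomb {k = suc k} c e = (c Fin.zero ·ᵥ e Fin.zero) +ᵥ lincomb (c ∘ Fin.suc) (e ∘ Fin.suc)

  LinearlyIndependent : ∀ {n k} → (Fin k → Vect n) → Set
  LinearlyIndependent e = ∀ c → lincomb c e ≡ zeroᵥ → ∀ i → c i ≡ 0#

  Spans : ∀ {n k} → (Fin k → Vect n) → Set
  Spans {n} e = ∀ (v : Vect n) → ∃ λ c → lincomb c e ≡ v

  IsBasis : ∀ {n} → (Fin n → Vect n) → Set
  IsBasis e = LinearlyIndependent e × Spans e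

  IsRank1Kakeya : ∀ {n} → (Vect n → Set) → Set
  IsRank1Kakeya {n} K =
    ∀ (d : Vect n) → d ≢ zeroᵥ → ∃ λ (v : Vect n) → ∀ (t : Carrier) → K (v +ᵥ (t ·ᵥ d))

  SetA : ∀ {n} → (Fin n → Vect n) → Vect n → Set
  SetA e x = ∃ λ ε → (∀ i → ε i ≢ 0#) × lincomb ε e ≡ x

  SetB : ∀ {n} → (Fin n → Vect n) → Vect n → Set
  SetB e x = ∃ λ (ε : Fin _ → Bool) → lincomb (λ i → if ε i then 1# else 0#) e ≡ x

  SetK : ∀ {n} → (Fin n → Vect n) → Vect n → Set
  SetK e x = SetA e x ⊎ SetB e x

{-# OPTIONS --safe #-}
module Submission where

-- Write a direction d as Σ cᵢ eᵢ and start the line at Σ [cᵢ = 0] eᵢ.  Its point at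
-- parameter t has coefficients [cᵢ = 0] + t cᵢ: for t = 0 these lie in {0,1}, and for
-- t ≠ 0 they are all non-zero, so the line lies in B ∪ A.  For the size, coordinates with
-- respect to a basis are unique, so K is in bijection with (F_q^×)ⁿ ⊎ ({0,1}ⁿ ∖ {(1,…,1)}),
-- the all-ones vector being the only common point of A and B.

open import Defs
open import Data.Nat using (ℕ; zero; suc; _≤_; _+_; _*_; _^_; _∸_)
open import Data.Nat.Properties using (+-suc)
open import Data.Fin using (Fin)
import Data.Fin as Fin
open import Data.Bool using (Bool; true; false; if_then_else_)
import Data.Bool as Bool
open import Data.Vec using (Vec; []; _∷_; lookup; replicate; tabulate)
import Data.Vec as Vec
open import Data.Vec.Properties using (∷-injective; ≡-dec; lookup-map; lookup-replicate; lookup∘tabulate)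
open import Data.Vec.Relation.Binary.Pointwise.Extensional using (ext; Pointwise-≡⇒≡)
open import Data.List using (List; []; _∷_; _++_; length; filter; cartesianProductWith)
import Data.List as List
open import Data.List.Properties using (length-++; length-map; length-tabulate; filter-all)
open import Data.List.Membership.Propositional using (_∈_)
open import Data.List.Membership.Propositional.Properties
  using (∈-lookup; ∈-map⁺; ∈-map⁻; ∈-++⁺ˡ; ∈-++⁺ʳ; ∈-++⁻; ∈-filter⁺; ∈-filter⁻; ∈-tabulate⁺;
         ∈-cartesianProductWith⁺; ∈-cartesianProductWith⁻)
open import Data.List.Relation.Unary.Any using (here; there; index)
open import Data.List.Relation.Unary.Any.Properties using (lookup-index)
import Data.List.Relation.Unary.All as All
import Data.List.Relation.Unary.AllPairs as AllPairs
open import Data.List.Relation.Unary.Unique.Propositional using (Unique)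
import Data.List.Relation.Unary.Unique.Propositional.Properties as Unique
open import Data.Product using (_×_; _,_; proj₂)
open import Data.Sum using (inj₁; inj₂)
open import Data.Empty using (⊥-elim)
open import Function using (_∘_; _↔_; Inverse; Injection)
open import Function.Definitions using (Injective)
open import Function.Properties.Inverse using (↔⇒↣)
open import Function.Construct.Symmetry using (↔-sym)
open import Level using (0ℓ)
open import Relation.Binary.Definitions using (DecidableEquality)
open import Relation.Binary.PropositionalEquality
open import Relation.Nullary using (¬_; Dec; yes; no; does; ¬?)
open import Relation.Nullary.Decidable using (via-injection)
open import Algebra.Bundles using (CommutativeRing)
open import Algebra.Structures using (IsCommutativeRing)
import Algebra.Properties.CommutativeSemigroup as CommutativeSemigroupProperties
import Algebra.Properties.Group as GroupProperties

open ≡-Reasoning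

module _ {A : Set} where

  lookup-injective : {xs : List A} → Unique xs → Injective _≡_ _≡_ (List.lookup xs)
  lookup-injective (_ AllPairs.∷ _) {Fin.zero} {Fin.zero} _ = refl
  lookup-injective (x∉xs AllPairs.∷ _) {Fin.zero} {Fin.suc j} x≡xsⱼ =
    ⊥-elim (All.lookup x∉xs (∈-lookup j) x≡xsⱼ)
  lookup-injective (x∉xs AllPairs.∷ _) {Fin.suc i} {Fin.zero} xsᵢ≡x =
    ⊥-elim (All.lookup x∉xs (∈-lookup i) (sym xsᵢ≡x))
  lookup-injective (_ AllPairs.∷ xs!) {Fin.suc i} {Fin.suc j} xsᵢ≡xsⱼ =
    cong Fin.suc (lookup-injective xs! xsᵢ≡xsⱼ)

  Unique⇒HasSize : {S : A → Set} {xs : List A} → Unique xs →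
    (∀ x → x ∈ xs → S x) → (∀ x → S x → x ∈ xs) → HasSize S (length xs)
  Unique⇒HasSize {xs = xs} xs! sound complete =
    List.lookup xs , lookup-injective xs! , (λ i → sound _ (∈-lookup i)) ,
    λ x Sx → index (complete x Sx) , sym (lookup-index (complete x Sx))

  length-filter-≢ : (_≟_ : DecidableEquality A) {x : A} {xs : List A} → Unique xs → x ∈ xs →
    suc (length (filter (λ y → ¬? (y ≟ x)) xs)) ≡ length xs
  length-filter-≢ _≟_ {x} {y ∷ xs} (y∉xs AllPairs.∷ xs!) x∈y∷xs with y ≟ x
  ... | yes refl = cong (suc ∘ length) (filter-all (λ z → ¬? (z ≟ y)) (All.map (_∘ sym) y∉xs))
  ... | no y≢x with x∈y∷xs
  ...   | here x≡y = ⊥-elim (y≢x (sym x≡y))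
  ...   | there x∈xs = cong suc (length-filter-≢ _≟_ xs! x∈xs)

module _ {A : Set} {m : ℕ} (A↔Fin : A ↔ Fin m) where
  open Inverse A↔Fin using (to; from; strictlyInverseʳ)

  enumerate : List A
  enumerate = List.tabulate from

  unique-enumerate : Unique enumerate
  unique-enumerate = Unique.tabulate⁺ (Injection.injective (↔⇒↣ (↔-sym A↔Fin)))

  ∈-enumerate : ∀ x → x ∈ enumerate
  ∈-enumerate x = subst (_∈ enumerate) (strictlyInverseʳ x) (∈-tabulate⁺ (to x))

  length-enumerate : length enumerate ≡ m
  length-enumerate = length-tabulate from

length-cartesianProductWith : {A B C : Set} (f : A → B → C) (xs : List A) (ys : List B) →
  length (cartesianProductWith f xs ys) ≡ length xs * length ys
length-cartesianProductWith f []       ys = refl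
length-cartesianProductWith f (x ∷ xs) ys = begin
  length (List.map (f x) ys ++ cartesianProductWith f xs ys)
    ≡⟨ length-++ (List.map (f x) ys) ⟩
  length (List.map (f x) ys) + length (cartesianProductWith f xs ys)
    ≡⟨ cong₂ _+_ (length-map (f x) ys) (length-cartesianProductWith f xs ys) ⟩
  length ys + length xs * length ys ∎

module _ {A : Set} where

  allVecs : List A → (n : ℕ) → List (Vec A n)
  allVecs xs zero    = [] ∷ []
  allVecs xs (suc n) = cartesianProductWith _∷_ xs (allVecs xs n)

  length-allVecs : (xs : List A) (n : ℕ) → length (allVecs xs n) ≡ length xs ^ n
  length-allVecs xs zero    = refl
  length-allVecs xs (suc n) =
    trans (length-cartesianProductWith _∷_ xs (allVecs xs n)) (cong (length xs *_) (length-allVecs xs n))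

  unique-allVecs : {xs : List A} → Unique xs → (n : ℕ) → Unique (allVecs xs n)
  unique-allVecs xs! zero    = All.[] AllPairs.∷ AllPairs.[]
  unique-allVecs xs! (suc n) = Unique.cartesianProductWith⁺ _∷_ ∷-injective xs! (unique-allVecs xs! n)

  ∈-allVecs⁺ : {xs : List A} {n : ℕ} (v : Vec A n) → (∀ i → lookup v i ∈ xs) → v ∈ allVecs xs n
  ∈-allVecs⁺ []      _     = here refl
  ∈-allVecs⁺ (x ∷ v) v⊆xs = ∈-cartesianProductWith⁺ _∷_ (v⊆xs Fin.zero) (∈-allVecs⁺ v (v⊆xs ∘ Fin.suc))

  ∈-allVecs⁻ : {xs : List A} {n : ℕ} (v : Vec A n) → v ∈ allVecs xs n → ∀ i → lookup v i ∈ xs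
  ∈-allVecs⁻ {xs} {suc n} (x ∷ v) x∷v∈ i
    with _ , _ , x∈xs , v∈ , refl ← ∈-cartesianProductWith⁻ _∷_ xs (allVecs xs n) x∷v∈ | i
  ... | Fin.zero  = x∈xs
  ... | Fin.suc j = ∈-allVecs⁻ v v∈ j

map-injective : {A B : Set} {f : A → B} {n : ℕ} →
  Injective _≡_ _≡_ f → Injective _≡_ _≡_ (Vec.map {n = n} f)
map-injective f-inj {[]}    {[]}    _  = refl
map-injective f-inj {x ∷ u} {y ∷ v} eq with fx≡fy , fu≡fv ← ∷-injective eq =
  cong₂ _∷_ (f-inj fx≡fy) (map-injective f-inj fu≡fv)

bools : List Bool
bools = true ∷ false ∷ []

unique-bools : Unique bools
unique-bools = ((λ ()) All.∷ All.[]) AllPairs.∷ (All.[] AllPairs.∷ AllPairs.[])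

∈-bools : ∀ b → b ∈ bools
∈-bools true  = here refl
∈-bools false = there (here refl)

≢allTrue? : ∀ {n} (b : Vec Bool n) → Dec (b ≢ replicate n true)
≢allTrue? {n} b = ¬? (≡-dec Bool._≟_ b (replicate n true))

notAllTrue : (n : ℕ) → List (Vec Bool n)
notAllTrue n = filter ≢allTrue? (allVecs bools n)

length-notAllTrue : ∀ n → suc (length (notAllTrue n)) ≡ 2 ^ n
length-notAllTrue n =
  trans (length-filter-≢ (≡-dec Bool._≟_) (unique-allVecs unique-bools n)
                         (∈-allVecs⁺ (replicate n true) (λ _ → ∈-bools _)))
        (length-allVecs bools n)

module _ {q : ℕ} (F : FiniteField q) where
  open FiniteField F renaming (_+_ to _+ᶠ_; _*_ to _*ᶠ_)
  open IsCommutativeRing isCommutativeRing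
    using (+-identityʳ; +-identityˡ; -‿inverseʳ; *-assoc; *-comm; *-identityˡ; zeroˡ; zeroʳ;
           distribˡ; distribʳ)

  commutativeRing : CommutativeRing 0ℓ 0ℓ
  commutativeRing = record { isCommutativeRing = isCommutativeRing }

  open CommutativeRing commutativeRing using (+-group; +-commutativeSemigroup)
  open CommutativeSemigroupProperties +-commutativeSemigroup using (interchange)
  open GroupProperties +-group using (x∙y⁻¹≈ε⇒x≈y)

  _≟ᶠ_ : DecidableEquality Carrier
  _≟ᶠ_ = via-injection (↔⇒↣ card) Fin._≟_

  *-≢0 : ∀ {x y} → x ≢ 0# → y ≢ 0# → x *ᶠ y ≢ 0#
  *-≢0 {x} {y} x≢0 y≢0 xy≡0 with x⁻¹ , xx⁻¹≡1 ← inverse x x≢0 = y≢0 (begin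
    y                 ≡⟨ *-identityˡ y ⟨
    1# *ᶠ y           ≡⟨ cong (_*ᶠ y) (trans (sym xx⁻¹≡1) (*-comm x x⁻¹)) ⟩
    (x⁻¹ *ᶠ x) *ᶠ y   ≡⟨ *-assoc x⁻¹ x y ⟩
    x⁻¹ *ᶠ (x *ᶠ y)   ≡⟨ cong (x⁻¹ *ᶠ_) xy≡0 ⟩
    x⁻¹ *ᶠ 0#         ≡⟨ zeroʳ x⁻¹ ⟩
    0#                ∎)

  infixl 6 _⊕_
  infixr 7 _⊙_

  _⊕_ : ∀ {n} → Vect F n → Vect F n → Vect F n
  _⊕_ = _+ᵥ_ F

  _⊙_ : ∀ {n} → Carrier → Vect F n → Vect F n
  _⊙_ = _·ᵥ_ F

  𝟎 : ∀ {n} → Vect F n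
  𝟎 = zeroᵥ F

  ⊕-identityʳ : ∀ {n} (u : Vect F n) → u ⊕ 𝟎 ≡ u
  ⊕-identityʳ []      = refl
  ⊕-identityʳ (x ∷ u) = cong₂ _∷_ (+-identityʳ x) (⊕-identityʳ u)

  ⊕-interchange : ∀ {n} (u v w x : Vect F n) → (u ⊕ v) ⊕ (w ⊕ x) ≡ (u ⊕ w) ⊕ (v ⊕ x)
  ⊕-interchange []      []      []      []      = refl
  ⊕-interchange (a ∷ u) (b ∷ v) (c ∷ w) (d ∷ x) = cong₂ _∷_ (interchange a b c d) (⊕-interchange u v w x)

  ⊙-zeroˡ : ∀ {n} (u : Vect F n) → 0# ⊙ u ≡ 𝟎
  ⊙-zeroˡ []      = refl
  ⊙-zeroˡ (x ∷ u) = cong₂ _∷_ (zeroˡ x) (⊙-zeroˡ u)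

  ⊙-zeroʳ : ∀ {n} t → t ⊙ 𝟎 {n} ≡ 𝟎
  ⊙-zeroʳ {zero}  t = refl
  ⊙-zeroʳ {suc n} t = cong₂ _∷_ (zeroʳ t) (⊙-zeroʳ t)

  ⊙-distribˡ : ∀ {n} t (u v : Vect F n) → t ⊙ (u ⊕ v) ≡ t ⊙ u ⊕ t ⊙ v
  ⊙-distribˡ t []      []      = refl
  ⊙-distribˡ t (x ∷ u) (y ∷ v) = cong₂ _∷_ (distribˡ t x y) (⊙-distribˡ t u v)

  ⊙-distribʳ : ∀ {n} s t (u : Vect F n) → (s +ᶠ t) ⊙ u ≡ s ⊙ u ⊕ t ⊙ u
  ⊙-distribʳ s t []      = refl
  ⊙-distribʳ s t (x ∷ u) = cong₂ _∷_ (distribʳ x s t) (⊙-distribʳ s t u)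

  ⊙-assoc : ∀ {n} s t (u : Vect F n) → (s *ᶠ t) ⊙ u ≡ s ⊙ t ⊙ u
  ⊙-assoc s t []      = refl
  ⊙-assoc s t (x ∷ u) = cong₂ _∷_ (*-assoc s t x) (⊙-assoc s t u)

  module _ {n : ℕ} where

    lincomb-cong : ∀ {k} (e : Fin k → Vect F n) {a b : Fin k → Carrier} →
      (∀ i → a i ≡ b i) → lincomb F a e ≡ lincomb F b e
    lincomb-cong {zero}  e a≗b = refl
    lincomb-cong {suc k} e a≗b =
      cong₂ _⊕_ (cong (_⊙ e Fin.zero) (a≗b Fin.zero)) (lincomb-cong (e ∘ Fin.suc) (a≗b ∘ Fin.suc))

    lincomb-+ : ∀ {k} (e : Fin k → Vect F n) (a b : Fin k → Carrier) →
      lincomb F (λ i → a i +ᶠ b i) e ≡ lincomb F a e ⊕ lincomb F b e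
    lincomb-+ {zero}  e a b = sym (⊕-identityʳ 𝟎)
    lincomb-+ {suc k} e a b = trans
      (cong₂ _⊕_ (⊙-distribʳ (a Fin.zero) (b Fin.zero) (e Fin.zero))
                 (lincomb-+ (e ∘ Fin.suc) (a ∘ Fin.suc) (b ∘ Fin.suc)))
      (⊕-interchange _ _ _ _)

    lincomb-* : ∀ {k} (e : Fin k → Vect F n) t (a : Fin k → Carrier) →
      lincomb F (λ i → t *ᶠ a i) e ≡ t ⊙ lincomb F a e
    lincomb-* {zero}  e t a = sym (⊙-zeroʳ t)
    lincomb-* {suc k} e t a = trans
      (cong₂ _⊕_ (⊙-assoc t (a Fin.zero) (e Fin.zero)) (lincomb-* (e ∘ Fin.suc) t (a ∘ Fin.suc)))
      (sym (⊙-distribˡ t _ _))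

    lincomb-0 : ∀ {k} (e : Fin k → Vect F n) → lincomb F (λ _ → 0#) e ≡ 𝟎
    lincomb-0 {zero}  e = refl
    lincomb-0 {suc k} e =
      trans (cong₂ _⊕_ (⊙-zeroˡ (e Fin.zero)) (lincomb-0 (e ∘ Fin.suc))) (⊕-identityʳ 𝟎)

    lincomb-injective : ∀ {k} (e : Fin k → Vect F n) → LinearlyIndependent F e →
      ∀ {a b} → lincomb F a e ≡ lincomb F b e → ∀ i → a i ≡ b i
    lincomb-injective e independent {a} {b} Σae≡Σbe i =
      x∙y⁻¹≈ε⇒x≈y (a i) (b i) (independent (λ j → a j +ᶠ - b j) Σ[a-b]e≡0 i)
      where
      Σ[a-b]e≡0 : lincomb F (λ j → a j +ᶠ - b j) e ≡ 𝟎
      Σ[a-b]e≡0 = begin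
        lincomb F (λ j → a j +ᶠ - b j) e      ≡⟨ lincomb-+ e a (-_ ∘ b) ⟩
        lincomb F a e ⊕ lincomb F (-_ ∘ b) e  ≡⟨ cong (_⊕ lincomb F (-_ ∘ b) e) Σae≡Σbe ⟩
        lincomb F b e ⊕ lincomb F (-_ ∘ b) e  ≡⟨ lincomb-+ e b (-_ ∘ b) ⟨
        lincomb F (λ j → b j +ᶠ - b j) e      ≡⟨ lincomb-cong e (-‿inverseʳ ∘ b) ⟩
        lincomb F (λ _ → 0#) e                ≡⟨ lincomb-0 e ⟩
        𝟎                                     ∎

  fromBool : Bool → Carrier
  fromBool b = if b then 1# else 0#

  fromBool-injective : Injective _≡_ _≡_ fromBool
  fromBool-injective {true}  {true}  _   = refl
  fromBool-injective {true}  {false} 1≡0 = ⊥-elim (0≢1 (sym 1≡0))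
  fromBool-injective {false} {true}  0≡1 = ⊥-elim (0≢1 0≡1)
  fromBool-injective {false} {false} _   = refl

  fromBool-≢0 : ∀ {b} → fromBool b ≢ 0# → b ≡ true
  fromBool-≢0 {true}  _    = refl
  fromBool-≢0 {false} 0≢0 = ⊥-elim (0≢0 refl)

  zeroIndicator : ∀ {k} → (Fin k → Carrier) → Fin k → Carrier
  zeroIndicator c i = fromBool (does (c i ≟ᶠ 0#))

  fromBool-does-+-≢0 : ∀ {t} → t ≢ 0# → ∀ {x} (x≟0 : Dec (x ≡ 0#)) →
    fromBool (does x≟0) +ᶠ t *ᶠ x ≢ 0#
  fromBool-does-+-≢0 {t} t≢0 (yes refl) 1+t0≡0 =
    0≢1 (sym (trans (sym (+-identityʳ 1#)) (trans (cong (1# +ᶠ_) (sym (zeroʳ t))) 1+t0≡0)))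
  fromBool-does-+-≢0 {t} t≢0 {x} (no x≢0) 0+tx≡0 =
    *-≢0 t≢0 x≢0 (trans (sym (+-identityˡ (t *ᶠ x))) 0+tx≡0)

  module _ {n : ℕ} (e : Fin n → Vect F n) where

    line-⊆-SetK : (c : Fin n → Carrier) (t : Carrier) →
      SetK F e (lincomb F (zeroIndicator c) e ⊕ t ⊙ lincomb F c e)
    line-⊆-SetK c t with t ≟ᶠ 0#
    ... | yes refl = inj₂ ((λ i → does (c i ≟ᶠ 0#)) , sym (begin
      lincomb F (zeroIndicator c) e ⊕ 0# ⊙ lincomb F c e
        ≡⟨ cong (lincomb F (zeroIndicator c) e ⊕_) (⊙-zeroˡ (lincomb F c e)) ⟩
      lincomb F (zeroIndicator c) e ⊕ 𝟎
        ≡⟨ ⊕-identityʳ (lincomb F (zeroIndicator c) e) ⟩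
      lincomb F (zeroIndicator c) e ∎))
    ... | no t≢0 = inj₁ (_ , (λ i → fromBool-does-+-≢0 t≢0 (c i ≟ᶠ 0#)) ,
      trans (lincomb-+ e (zeroIndicator c) (λ i → t *ᶠ c i)) (cong (_ ⊕_) (lincomb-* e t c)))

    SetK-isRank1Kakeya : Spans F e → IsRank1Kakeya F (SetK F e)
    SetK-isRank1Kakeya spans d _ with c , Σce≡d ← spans d =
      lincomb F (zeroIndicator c) e ,
      λ t → subst (λ u → SetK F e (_ ⊕ t ⊙ u)) Σce≡d (line-⊆-SetK c t)

  ≢0? : (x : Carrier) → Dec (x ≢ 0#)
  ≢0? x = ¬? (x ≟ᶠ 0#)

  units : List Carrier
  units = filter ≢0? (enumerate card)

  length-units : length units ≡ q ∸ 1
  length-units = cong (_∸ 1)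
    (trans (length-filter-≢ _≟ᶠ_ (unique-enumerate card) (∈-enumerate card 0#)) (length-enumerate card))

  ∈-units⁺ : ∀ {x} → x ≢ 0# → x ∈ units
  ∈-units⁺ x≢0 = ∈-filter⁺ ≢0? (∈-enumerate card _) x≢0

  ∈-units⁻ : ∀ {x} → x ∈ units → x ≢ 0#
  ∈-units⁻ x∈ = proj₂ (∈-filter⁻ ≢0? {xs = enumerate card} x∈)

  module _ {n : ℕ} where

    -- B adds only the {0,1}-vectors other than (1,…,1), which already comes from A.
    coordinatesK : List (Vect F n)
    coordinatesK = allVecs units n ++ List.map (Vec.map fromBool) (notAllTrue n)

    map-fromBool-∈-units⇒allTrue : (b : Vec Bool n) → Vec.map fromBool b ∈ allVecs units n →
      b ≡ replicate n true
    map-fromBool-∈-units⇒allTrue b b∈ = Pointwise-≡⇒≡ (ext λ i →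
      trans (fromBool-≢0 (∈-units⁻ (subst (_∈ units) (lookup-map i fromBool b) (∈-allVecs⁻ _ b∈ i))))
            (sym (lookup-replicate i true)))

    unique-coordinatesK : Unique coordinatesK
    unique-coordinatesK = Unique.++⁺ (unique-allVecs (Unique.filter⁺ ≢0? (unique-enumerate card)) n)
      (Unique.map⁺ (map-injective fromBool-injective)
                   (Unique.filter⁺ ≢allTrue? (unique-allVecs unique-bools n)))
      disjoint
      where
      disjoint : ∀ {v} → ¬ (v ∈ allVecs units n × v ∈ List.map (Vec.map fromBool) (notAllTrue n))
      disjoint (c∈units , c∈bools) with b , b∈ , refl ← ∈-map⁻ _ c∈bools =
        proj₂ (∈-filter⁻ ≢allTrue? {xs = allVecs bools n} b∈) (map-fromBool-∈-units⇒allTrue b c∈units)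

    map-fromBool-∈-coordinatesK : (b : Vec Bool n) → Vec.map fromBool b ∈ coordinatesK
    map-fromBool-∈-coordinatesK b with ≡-dec Bool._≟_ b (replicate n true)
    ... | yes refl = ∈-++⁺ˡ (∈-allVecs⁺ (Vec.map fromBool (replicate n true)) λ i →
      subst (_∈ units)
            (sym (trans (lookup-map i fromBool (replicate n true))
                        (cong fromBool (lookup-replicate i true))))
            (∈-units⁺ (λ 1≡0 → 0≢1 (sym 1≡0))))
    ... | no b≢1 = ∈-++⁺ʳ (allVecs units n)
      (∈-map⁺ (Vec.map fromBool) (∈-filter⁺ ≢allTrue? (∈-allVecs⁺ b (λ _ → ∈-bools _)) b≢1))

    length-coordinatesK : length coordinatesK ≡ (q ∸ 1) ^ n + 2 ^ n ∸ 1
    length-coordinatesK = begin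
      length coordinatesK
        ≡⟨ length-++ (allVecs units n) ⟩
      length (allVecs units n) + length (List.map (Vec.map fromBool) (notAllTrue n))
        ≡⟨ cong₂ _+_ (length-allVecs units n) (length-map (Vec.map fromBool) (notAllTrue n)) ⟩
      length units ^ n + length (notAllTrue n)
        ≡⟨ cong (λ m → m ^ n + length (notAllTrue n)) length-units ⟩
      (q ∸ 1) ^ n + length (notAllTrue n)
        ≡⟨ cong (_∸ 1) (+-suc ((q ∸ 1) ^ n) (length (notAllTrue n))) ⟨
      (q ∸ 1) ^ n + suc (length (notAllTrue n)) ∸ 1
        ≡⟨ cong (λ m → (q ∸ 1) ^ n + m ∸ 1) (length-notAllTrue n) ⟩
      (q ∸ 1) ^ n + 2 ^ n ∸ 1 ∎

  module _ {n : ℕ} (e : Fin n → Vect F n) where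

    fromCoordinates : Vect F n → Vect F n
    fromCoordinates c = lincomb F (lookup c) e

    elementsK : List (Vect F n)
    elementsK = List.map fromCoordinates coordinatesK

    ∈-elementsK⁻ : ∀ x → x ∈ elementsK → SetK F e x
    ∈-elementsK⁻ x x∈ with c , c∈ , refl ← ∈-map⁻ fromCoordinates x∈ with ∈-++⁻ (allVecs units n) c∈
    ... | inj₁ c∈units = inj₁ (lookup c , (λ i → ∈-units⁻ (∈-allVecs⁻ c c∈units i)) , refl)
    ... | inj₂ c∈bools with b , _ , refl ← ∈-map⁻ _ c∈bools =
      inj₂ (lookup b , lincomb-cong e (λ i → sym (lookup-map i fromBool b)))

    ∈-elementsK⁺ : ∀ x → SetK F e x → x ∈ elementsK
    ∈-elementsK⁺ x (inj₁ (ε , ε≢0 , Σεe≡x)) = subst (_∈ elementsK)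
      (trans (lincomb-cong e (lookup∘tabulate ε)) Σεe≡x)
      (∈-map⁺ fromCoordinates (∈-++⁺ˡ (∈-allVecs⁺ (tabulate ε) λ i →
        subst (_∈ units) (sym (lookup∘tabulate ε i)) (∈-units⁺ (ε≢0 i)))))
    ∈-elementsK⁺ x (inj₂ (ε , Σεe≡x)) = subst (_∈ elementsK)
      (trans (lincomb-cong e λ i →
                trans (lookup-map i fromBool (tabulate ε)) (cong fromBool (lookup∘tabulate ε i)))
             Σεe≡x)
      (∈-map⁺ fromCoordinates (map-fromBool-∈-coordinatesK (tabulate ε)))

    SetK-hasSize : LinearlyIndependent F e → HasSize (SetK F e) ((q ∸ 1) ^ n + 2 ^ n ∸ 1)
    SetK-hasSize independent = subst (HasSize (SetK F e))
      (trans (length-map fromCoordinates coordinatesK) (length-coordinatesK {n}))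
      (Unique⇒HasSize (Unique.map⁺ fromCoordinates-injective unique-coordinatesK)
                      ∈-elementsK⁻ ∈-elementsK⁺)
      where
      fromCoordinates-injective : ∀ {c c′} → fromCoordinates c ≡ fromCoordinates c′ → c ≡ c′
      fromCoordinates-injective eq = Pointwise-≡⇒≡ (ext (lincomb-injective e independent eq))

theorem4 : (n q : ℕ) → 1 ≤ n → IsPrimePower q → (F : FiniteField q)
    → (e : Fin n → Vec (FiniteField.Carrier F) n) → IsBasis F e
    → IsRank1Kakeya F (SetK F e) × HasSize (SetK F e) ((q ∸ 1) ^ n + 2 ^ n ∸ 1)
theorem4 n q _ _ F e (independent , spans) = SetK-isRank1Kakeya F e spans , SetK-hasSize F e independent
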